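{- Let the Domb numbers $D_n$ be defined by $D_0=1$, $D_1=4$ and $n^3D_n=2(2n-1)(5n^2-5n+2)D_{n-1}-64(n-1)^3D_{n-2}$ for $n\geq 2$. The sequence $\{D_n\}_{n\geq 0}$ is ratio log-concave, and the sequence $\{\sqrt[n]{D_n}\}_{n\geq 1}$ is strictly log-concave.
   Context: A sequence $(x_n)_{n\ge m}$ of positive reals is log-concave if $x_n^2\ge x_{n-1}x_{n+1}$ for all $n\ge m+1$, strictly log-concave if the inequality is strict. A sequence $(a_n)_{n\ge m}$ of positive reals is ratio log-concave if $(a_{n+1}/a_n)_{n\ge m}$ is log-concave. -}

module Defs where

open import Data.Nat as ℕ using (ℕ; zero; suc)
open import Data.Integer using (+_)
open import Data.Rational using (ℚ; 0ℚ; 1ℚ; _*_; _-_; _÷_; _<_; _≤_; _/_; Positive; positive)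
open import Data.Rational.Properties using (pos⇒nonZero)
open import Data.Product using (Σ; _×_)
open import Relation.Binary.PropositionalEquality using (_≡_)

ℕ→ℚ : ℕ → ℚ
ℕ→ℚ n = + n / 1

_^_ : ℚ → ℕ → ℚ
x ^ zero = 1ℚ
x ^ suc k = x * (x ^ k)

LogConcaveFrom : ℕ → (ℕ → ℚ) → Set
LogConcaveFrom m x =
  (∀ n → m ℕ.≤ n → 0ℚ < x n) ×
  (∀ n → suc m ℕ.≤ n → x (ℕ.pred n) * x (suc n) ≤ x n * x n)

RatioLogConcave : (ℕ → ℚ) → Set
RatioLogConcave a =
  Σ (∀ n → 0ℚ < a n) λ pos →
    LogConcaveFrom 0
      (λ n → _÷_ (a (suc n)) (a n) {{pos⇒nonZero (a n) {{positive (pos n)}}}})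

-- Without real numbers, the strict inequality
--   (a_n^{1/n})^2 > a_{n-1}^{1/(n-1)} a_{n+1}^{1/(n+1)}   (n ≥ 2)
-- is stated after raising both (positive) sides to the power (n-1) n (n+1):
--   a_n^{2(n-1)(n+1)} > a_{n-1}^{n(n+1)} a_{n+1}^{(n-1)n}.
RootSeqStrictlyLogConcave : (ℕ → ℚ) → Set
RootSeqStrictlyLogConcave a =
  (∀ n → 1 ℕ.≤ n → 0ℚ < a n) ×
  (∀ n → 2 ℕ.≤ n →
     (a (ℕ.pred n) ^ (n ℕ.* suc n)) * (a (suc n) ^ (ℕ.pred n ℕ.* n))
       < a n ^ (2 ℕ.* (ℕ.pred n ℕ.* suc n)))

-- The Domb recurrence: D_0 = 1, D_1 = 4, and for n ≥ 2
--   n^3 D_n = 2(2n-1)(5n^2-5n+2) D_{n-1} - 64 (n-1)^3 D_{n-2}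
-- (written with n = k+2 to avoid natural-number subtraction).
IsDomb : (ℕ → ℚ) → Set
IsDomb D =
  (D 0 ≡ 1ℚ) × (D 1 ≡ ℕ→ℚ 4) ×
  (∀ k → ℕ→ℚ ((2 ℕ.+ k) ℕ.^ 3) * D (2 ℕ.+ k)
         ≡
         ℕ→ℚ (2 ℕ.* (3 ℕ.+ 2 ℕ.* k) ℕ.* (5 ℕ.* (2 ℕ.+ k) ℕ.* (1 ℕ.+ k) ℕ.+ 2)) * D (1 ℕ.+ k)
           - ℕ→ℚ (64 ℕ.* (1 ℕ.+ k) ℕ.^ 3) * D k)

{-# OPTIONS --safe #-}

-- Write r_n = D_{n+1}/D_n.  The bounds (16n−8)/(n+1) ≤ r_n ≤ 32n/(2n+3) (n ≥ 2) propagate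
-- along the recurrence, and on that interval the recurrence forces r_{n−1} r_{n+1} ≤ r_n²,
-- i.e. D_n³ D_{n+2} ≤ D_{n−1} D_{n+1}³.  Each of these three implications is witnessed by a
-- polynomial identity: a positive polynomial in n times the conclusion equals a combination
-- of the hypotheses with polynomial coefficients that are nonnegative for n ≥ 0, plus
-- multiples of the recurrence; the ring solver checks the identities.
-- Strict log-concavity of D_n^{1/n} then holds for any positive sequence with log-concave
-- ratios once it holds at n = 2: in ratio form it reads a_n² r_n^{n(n−1)} < r_{n−1}^{n(n+1)},
-- and multiplying by r_n² r_{n+1}^{n(n+1)} and using r_{n−1} r_{n+1} ≤ r_n² turns the case n
-- into the case n + 1.
module Submission where

open import Defs
open import Algebra.Bundles using (CommutativeRing)
import Algebra.Properties.CommutativeSemiring.Exp as Exp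
import Data.Integer as ℤ
import Data.Integer.Properties as ℤP
open import Data.List using (List; []; _∷_)
open import Data.List.Relation.Unary.All using (All; []; _∷_)
open import Data.Nat as ℕ using (ℕ; zero; suc; z≤n; s≤s)
import Data.Nat.Coprimality as Coprimality
import Data.Nat.Solver as ℕSolver
open import Data.Nat.Tactic.RingSolver using (solve-∀)
open import Data.Product using (_×_; _,_; proj₁; proj₂)
open import Data.Rational as ℚ using (ℚ; 0ℚ; 1ℚ; _+_; _*_; _-_; -_; _≤_; _<_; mkℚ)
import Data.Rational.Properties as ℚP
import Data.Rational.Solver as ℚSolver
open import Relation.Binary.PropositionalEquality
open import Relation.Nullary.Decidable using (True; toWitness)

ℕ→ℚ≡mkℚ : ∀ n → ℕ→ℚ n ≡ mkℚ (ℤ.+ n) 0 (Coprimality.sym (Coprimality.1-coprimeTo n))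
ℕ→ℚ≡mkℚ n = ℚP.normalize-coprime _

ℕ→ℚ-+ : ∀ m n → ℕ→ℚ (m ℕ.+ n) ≡ ℕ→ℚ m + ℕ→ℚ n
ℕ→ℚ-+ m n rewrite ℕ→ℚ≡mkℚ m | ℕ→ℚ≡mkℚ n =
  ℚP./-cong {p₁ = ℤ.+ (m ℕ.+ n)} {q₁ = 1}
    (trans (ℤP.pos-+ m n) (sym (cong₂ ℤ._+_ (ℤP.*-identityʳ (ℤ.+ m)) (ℤP.*-identityʳ (ℤ.+ n))))) refl

ℕ→ℚ-* : ∀ m n → ℕ→ℚ (m ℕ.* n) ≡ ℕ→ℚ m * ℕ→ℚ n
ℕ→ℚ-* m n rewrite ℕ→ℚ≡mkℚ m | ℕ→ℚ≡mkℚ n =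
  ℚP./-cong {p₁ = ℤ.+ (m ℕ.* n)} {q₁ = 1} (ℤP.pos-* m n) refl

ℕ→ℚ-mono-≤ : ∀ {m n} → m ℕ.≤ n → ℕ→ℚ m ≤ ℕ→ℚ n
ℕ→ℚ-mono-≤ {m} {n} m≤n rewrite ℕ→ℚ≡mkℚ m | ℕ→ℚ≡mkℚ n =
  ℚ.*≤* (subst₂ ℤ._≤_ (sym (ℤP.*-identityʳ (ℤ.+ m))) (sym (ℤP.*-identityʳ (ℤ.+ n))) (ℤ.+≤+ m≤n))

ℕ→ℚ-mono-< : ∀ {m n} → m ℕ.< n → ℕ→ℚ m < ℕ→ℚ n
ℕ→ℚ-mono-< {m} {n} m<n rewrite ℕ→ℚ≡mkℚ m | ℕ→ℚ≡mkℚ n =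
  ℚ.*<* (subst₂ ℤ._<_ (sym (ℤP.*-identityʳ (ℤ.+ m))) (sym (ℤP.*-identityʳ (ℤ.+ n))) (ℤ.+<+ m<n))

ℕ→ℚ-nonNeg : ∀ n → 0ℚ ≤ ℕ→ℚ n
ℕ→ℚ-nonNeg n = ℕ→ℚ-mono-≤ {0} {n} z≤n

ℕ→ℚ-pos : ∀ n → 0ℚ < ℕ→ℚ (suc n)
ℕ→ℚ-pos n = ℕ→ℚ-mono-< {0} {suc n} (s≤s z≤n)

+-nonNeg : ∀ {p q} → 0ℚ ≤ p → 0ℚ ≤ q → 0ℚ ≤ p + q
+-nonNeg {p} {q} 0≤p 0≤q = subst (_≤ p + q) (ℚP.+-identityʳ 0ℚ) (ℚP.+-mono-≤ 0≤p 0≤q)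

*-nonNeg : ∀ {p q} → 0ℚ ≤ p → 0ℚ ≤ q → 0ℚ ≤ p * q
*-nonNeg {p} {q} 0≤p 0≤q =
  subst (_≤ p * q) (ℚP.*-zeroʳ p) (ℚP.*-monoˡ-≤-nonNeg p {{ℚ.nonNegative 0≤p}} 0≤q)

*-pos : ∀ {p q} → 0ℚ < p → 0ℚ < q → 0ℚ < p * q
*-pos {p} {q} 0<p 0<q =
  ℚP.positive⁻¹ (p * q) {{ℚP.pos*pos⇒pos p {{ℚ.positive 0<p}} q {{ℚ.positive 0<q}}}}

*-cancelˡ-pos : ∀ {m p} → 0ℚ ≤ m → 0ℚ < m * p → 0ℚ < p
*-cancelˡ-pos {m} {p} 0≤m 0<mp =
  ℚP.*-cancelˡ-<-nonNeg m {{ℚ.nonNegative 0≤m}} (subst (_< m * p) (sym (ℚP.*-zeroʳ m)) 0<mp)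

*-cancelˡ-≡-pos : ∀ {m p q} → 0ℚ < m → m * p ≡ m * q → p ≡ q
*-cancelˡ-≡-pos {m} 0<m mp≡mq = ℚP.≤-antisym
  (ℚP.*-cancelˡ-≤-pos m {{ℚ.positive 0<m}} (ℚP.≤-reflexive mp≡mq))
  (ℚP.*-cancelˡ-≤-pos m {{ℚ.positive 0<m}} (ℚP.≤-reflexive (sym mp≡mq)))

0≤q-p⇒p≤q : ∀ {p q} → 0ℚ ≤ q - p → p ≤ q
0≤q-p⇒p≤q {p} {q} 0≤q-p = subst₂ _≤_ (ℚP.+-identityˡ p) q-p+p≡q (ℚP.+-monoˡ-≤ p 0≤q-p)
  where
  q-p+p≡q : (q - p) + p ≡ q
  q-p+p≡q = trans (ℚP.+-assoc q (- p) p)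
              (trans (cong (q +_) (ℚP.+-inverseˡ p)) (ℚP.+-identityʳ q))

p≡q⇒p-q≡0 : ∀ {p q} → p ≡ q → p - q ≡ 0ℚ
p≡q⇒p-q≡0 {p} refl = ℚP.+-inverseʳ p

≤-by-decision : ∀ p q → {True (p ℚP.≤? q)} → p ≤ q
≤-by-decision p q {p≤q} = toWitness p≤q

<-by-decision : ∀ p q → {True (p ℚP.<? q)} → p < q
<-by-decision p q {p<q} = toWitness p<q

module ℚ^ = Exp (CommutativeRing.commutativeSemiring ℚP.+-*-commutativeRing)

^≡ℚ^ : ∀ x n → x ^ n ≡ x ℚ^.^ n
^≡ℚ^ x zero    = refl
^≡ℚ^ x (suc n) = cong (x *_) (^≡ℚ^ x n)

^-distribˡ-+-* : ∀ x m n → x ^ (m ℕ.+ n) ≡ x ^ m * x ^ n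
^-distribˡ-+-* x m n = trans (^≡ℚ^ x (m ℕ.+ n))
  (trans (ℚ^.^-homo-* x m n) (sym (cong₂ _*_ (^≡ℚ^ x m) (^≡ℚ^ x n))))

^-distribʳ-* : ∀ x y n → (x * y) ^ n ≡ x ^ n * y ^ n
^-distribʳ-* x y n = trans (^≡ℚ^ (x * y) n)
  (trans (ℚ^.^-distrib-* x y n) (sym (cong₂ _*_ (^≡ℚ^ x n) (^≡ℚ^ y n))))

^-nonNeg : ∀ {x} n → 0ℚ ≤ x → 0ℚ ≤ x ^ n
^-nonNeg zero    0≤x = ℕ→ℚ-nonNeg 1
^-nonNeg (suc n) 0≤x = *-nonNeg 0≤x (^-nonNeg n 0≤x)

^-pos : ∀ {x} n → 0ℚ < x → 0ℚ < x ^ n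
^-pos zero    0<x = ℕ→ℚ-pos 0
^-pos (suc n) 0<x = *-pos 0<x (^-pos n 0<x)

^-mono-≤ : ∀ {x y} n → 0ℚ ≤ x → x ≤ y → x ^ n ≤ y ^ n
^-mono-≤ zero 0≤x x≤y = ℚP.≤-refl
^-mono-≤ {x} {y} (suc n) 0≤x x≤y = ℚP.≤-trans
  (ℚP.*-monoʳ-≤-nonNeg (x ^ n) {{ℚ.nonNegative (^-nonNeg n 0≤x)}} x≤y)
  (ℚP.*-monoˡ-≤-nonNeg y {{ℚ.nonNegative (ℚP.≤-trans 0≤x x≤y)}} (^-mono-≤ n 0≤x x≤y))

module RatioSequence (a : ℕ → ℚ) (a-pos : ∀ n → 0ℚ < a n) where

  private instance
    a-nonZero : ∀ {n} → ℚ.NonZero (a n)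
    a-nonZero {n} = ℚP.pos⇒nonZero (a n) {{ℚ.positive (a-pos n)}}

  ratio : ℕ → ℚ
  ratio n = a (suc n) ℚ.÷ a n

  ratio*a≡a : ∀ n → ratio n * a n ≡ a (suc n)
  ratio*a≡a n = begin
    a (suc n) * ℚ.1/ a n * a n    ≡⟨ ℚP.*-assoc (a (suc n)) (ℚ.1/ a n) (a n) ⟩
    a (suc n) * (ℚ.1/ a n * a n)  ≡⟨ cong (a (suc n) *_) (ℚP.*-inverseˡ (a n)) ⟩
    a (suc n) * 1ℚ               ≡⟨ ℚP.*-identityʳ (a (suc n)) ⟩
    a (suc n)                    ∎
    where open ≡-Reasoning

  ratio-pos : ∀ n → 0ℚ < ratio n
  ratio-pos n = ℚP.*-cancelʳ-<-nonNeg (a n) {{ℚ.nonNegative (ℚP.<⇒≤ (a-pos n))}}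
    (subst₂ _<_ (sym (ℚP.*-zeroˡ (a n))) (sym (ratio*a≡a n)) (a-pos (suc n)))

  ratio-logConcave : (∀ n → a (suc n) ^ 3 * a (3 ℕ.+ n) ≤ a n * a (2 ℕ.+ n) ^ 3) →
                     ∀ n → ratio n * ratio (2 ℕ.+ n) ≤ ratio (1 ℕ.+ n) * ratio (1 ℕ.+ n)
  ratio-logConcave cubes n =
    ℚP.*-cancelˡ-≤-pos w {{ℚ.positive 0<w}} (subst₂ _≤_ lhs rhs (cubes n))
    where
    open ℚSolver.+-*-Solver
    u = a n
    p = ratio n
    q = ratio (1 ℕ.+ n)
    s = ratio (2 ℕ.+ n)
    w = p ^ 3 * q * u ^ 4
    0<w : 0ℚ < w
    0<w = *-pos (*-pos (^-pos 3 (ratio-pos n)) (ratio-pos (1 ℕ.+ n))) (^-pos 4 (a-pos n))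
    a₁ : a (1 ℕ.+ n) ≡ p * u
    a₁ = sym (ratio*a≡a n)
    a₂ : a (2 ℕ.+ n) ≡ q * (p * u)
    a₂ = trans (sym (ratio*a≡a (1 ℕ.+ n))) (cong (q *_) a₁)
    a₃ : a (3 ℕ.+ n) ≡ s * (q * (p * u))
    a₃ = trans (sym (ratio*a≡a (2 ℕ.+ n))) (cong (s *_) a₂)
    lhs : a (1 ℕ.+ n) ^ 3 * a (3 ℕ.+ n) ≡ w * (p * s)
    lhs = trans (cong₂ (λ y z → y ^ 3 * z) a₁ a₃)
      (solve 4 (λ u p q s → (p :* u) :^ 3 :* (s :* (q :* (p :* u)))
                          := (p :^ 3 :* q :* u :^ 4) :* (p :* s)) refl u p q s)
    rhs : u * a (2 ℕ.+ n) ^ 3 ≡ w * (q * q)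
    rhs = trans (cong (λ y → u * y ^ 3) a₂)
      (solve 4 (λ u p q s → u :* (q :* (p :* u)) :^ 3
                          := (p :^ 3 :* q :* u :^ 4) :* (q :* q)) refl u p q s)

  ratioLogConcave : (∀ n → ratio n * ratio (2 ℕ.+ n) ≤ ratio (1 ℕ.+ n) * ratio (1 ℕ.+ n)) →
                    RatioLogConcave a
  ratioLogConcave lc = a-pos , (λ n _ → ratio-pos n) , λ { zero () ; (suc n) _ → lc n }

  RootInequality : ℕ → Set
  RootInequality n =
    a (ℕ.pred n) ^ (n ℕ.* suc n) * a (suc n) ^ (ℕ.pred n ℕ.* n) < a n ^ (2 ℕ.* (ℕ.pred n ℕ.* suc n))

  -- The root inequality at n = m + 2 after substituting a_{n±1} via r_{n−1} and r_n and
  -- cancelling powers of a_n:  a_n² r_n^{n(n−1)} < r_{n−1}^{n(n+1)}.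
  RatioRootInequality : ℕ → Set
  RatioRootInequality m =
    a (2 ℕ.+ m) * a (2 ℕ.+ m) * ratio (2 ℕ.+ m) ^ ((1 ℕ.+ m) ℕ.* (2 ℕ.+ m))
      < ratio (1 ℕ.+ m) ^ ((2 ℕ.+ m) ℕ.* (3 ℕ.+ m))

  rootScale : ℕ → ℚ
  rootScale m = a (1 ℕ.+ m) ^ ((2 ℕ.+ m) ℕ.* (3 ℕ.+ m)) * a (2 ℕ.+ m) ^ (m ℕ.* (3 ℕ.+ m))

  rootScale-pos : ∀ m → 0ℚ < rootScale m
  rootScale-pos m = *-pos (^-pos ((2 ℕ.+ m) ℕ.* (3 ℕ.+ m)) (a-pos (1 ℕ.+ m)))
                          (^-pos (m ℕ.* (3 ℕ.+ m)) (a-pos (2 ℕ.+ m)))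

  rootScale-lhs : ∀ m →
    rootScale m * (a (2 ℕ.+ m) * a (2 ℕ.+ m) * ratio (2 ℕ.+ m) ^ ((1 ℕ.+ m) ℕ.* (2 ℕ.+ m)))
      ≡ a (1 ℕ.+ m) ^ ((2 ℕ.+ m) ℕ.* (3 ℕ.+ m)) * a (3 ℕ.+ m) ^ ((1 ℕ.+ m) ℕ.* (2 ℕ.+ m))
  rootScale-lhs m = begin
    F ^ Q * E ^ e * (E * E * r ^ P)     ≡⟨ rearrange (F ^ Q) (E ^ e) E (r ^ P) ⟩
    F ^ Q * (r ^ P * E ^ (2 ℕ.+ e))     ≡⟨ cong (λ k → F ^ Q * (r ^ P * E ^ k)) (exponent m) ⟩
    F ^ Q * (r ^ P * E ^ P)             ≡⟨ cong (F ^ Q *_) (^-distribʳ-* r E P) ⟨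
    F ^ Q * (r * E) ^ P                 ≡⟨ cong (λ y → F ^ Q * y ^ P) (ratio*a≡a (2 ℕ.+ m)) ⟩
    F ^ Q * a (3 ℕ.+ m) ^ P             ∎
    where
    open ≡-Reasoning
    F = a (1 ℕ.+ m)
    E = a (2 ℕ.+ m)
    r = ratio (2 ℕ.+ m)
    P = (1 ℕ.+ m) ℕ.* (2 ℕ.+ m)
    Q = (2 ℕ.+ m) ℕ.* (3 ℕ.+ m)
    e = m ℕ.* (3 ℕ.+ m)
    rearrange : ∀ x y z t → x * y * (z * z * t) ≡ x * (t * (z * (z * y)))
    rearrange = solve 4 (λ x y z t → x :* y :* (z :* z :* t)
                                  := x :* (t :* (z :* (z :* y)))) refl
      where open ℚSolver.+-*-Solver
    exponent : ∀ m → 2 ℕ.+ m ℕ.* (3 ℕ.+ m) ≡ (1 ℕ.+ m) ℕ.* (2 ℕ.+ m)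
    exponent = solve-∀

  rootScale-rhs : ∀ m →
    rootScale m * ratio (1 ℕ.+ m) ^ ((2 ℕ.+ m) ℕ.* (3 ℕ.+ m))
      ≡ a (2 ℕ.+ m) ^ (2 ℕ.* ((1 ℕ.+ m) ℕ.* (3 ℕ.+ m)))
  rootScale-rhs m = begin
    F ^ Q * E ^ e * r ^ Q      ≡⟨ rearrange (F ^ Q) (E ^ e) (r ^ Q) ⟩
    r ^ Q * F ^ Q * E ^ e      ≡⟨ cong (_* E ^ e) (^-distribʳ-* r F Q) ⟨
    (r * F) ^ Q * E ^ e        ≡⟨ cong (λ y → y ^ Q * E ^ e) (ratio*a≡a (1 ℕ.+ m)) ⟩
    E ^ Q * E ^ e              ≡⟨ ^-distribˡ-+-* E Q e ⟨
    E ^ (Q ℕ.+ e)              ≡⟨ cong (E ^_) (exponent m) ⟩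
    E ^ (2 ℕ.* ((1 ℕ.+ m) ℕ.* (3 ℕ.+ m))) ∎
    where
    open ≡-Reasoning
    F = a (1 ℕ.+ m)
    E = a (2 ℕ.+ m)
    r = ratio (1 ℕ.+ m)
    Q = (2 ℕ.+ m) ℕ.* (3 ℕ.+ m)
    e = m ℕ.* (3 ℕ.+ m)
    rearrange : ∀ x y z → x * y * z ≡ z * x * y
    rearrange = solve 3 (λ x y z → x :* y :* z := z :* x :* y) refl
      where open ℚSolver.+-*-Solver
    exponent : ∀ m → (2 ℕ.+ m) ℕ.* (3 ℕ.+ m) ℕ.+ m ℕ.* (3 ℕ.+ m) ≡ 2 ℕ.* ((1 ℕ.+ m) ℕ.* (3 ℕ.+ m))
    exponent = solve-∀

  ratioRoot⇒root : ∀ m → RatioRootInequality m → RootInequality (2 ℕ.+ m)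
  ratioRoot⇒root m ineq = subst₂ _<_ (rootScale-lhs m) (rootScale-rhs m)
    (ℚP.*-monoʳ-<-pos (rootScale m) {{ℚ.positive (rootScale-pos m)}} ineq)

  root⇒ratioRoot : ∀ m → RootInequality (2 ℕ.+ m) → RatioRootInequality m
  root⇒ratioRoot m ineq =
    ℚP.*-cancelˡ-<-nonNeg (rootScale m) {{ℚ.nonNegative (ℚP.<⇒≤ (rootScale-pos m))}} (subst₂ _<_ (sym (rootScale-lhs m)) (sym (rootScale-rhs m)) ineq)

  ratioRoot-step : (∀ n → ratio (1 ℕ.+ n) * ratio (3 ℕ.+ n) ≤ ratio (2 ℕ.+ n) * ratio (2 ℕ.+ n)) →
                   ∀ m → RatioRootInequality m → RatioRootInequality (suc m)
  ratioRoot-step lc m ineq = ℚP.*-cancelˡ-<-nonNeg T {{ℚ.nonNegative (ℚP.<⇒≤ 0<T)}} (begin-strict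
    T * (a (3 ℕ.+ m) * a (3 ℕ.+ m) * s ^ Q)
      ≡⟨ cong (λ y → T * (y * y * s ^ Q)) (sym (ratio*a≡a (2 ℕ.+ m))) ⟩
    T * (r * E * (r * E) * s ^ Q)
      ≡⟨ rearrange r E T (s ^ Q) ⟩
    r * r * (E * E * T * s ^ Q)
      <⟨ ℚP.*-monoʳ-<-pos (r * r) {{ℚ.positive 0<r*r}}
           (ℚP.*-monoˡ-<-pos (s ^ Q) {{ℚ.positive (^-pos Q 0<s)}} ineq) ⟩
    r * r * (q ^ Q * s ^ Q)
      ≡⟨ cong (r * r *_) (^-distribʳ-* q s Q) ⟨
    r * r * (q * s) ^ Q
      ≤⟨ ℚP.*-monoˡ-≤-nonNeg (r * r) {{ℚ.nonNegative (ℚP.<⇒≤ 0<r*r)}}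
           (^-mono-≤ Q (ℚP.<⇒≤ (*-pos 0<q 0<s)) (lc m)) ⟩
    r * r * (r * r) ^ Q
      ≡⟨ cong (r * r *_) (trans (^-distribʳ-* r r Q) (sym (^-distribˡ-+-* r Q Q))) ⟩
    r * r * r ^ (Q ℕ.+ Q)
      ≡⟨ ℚP.*-assoc r r (r ^ (Q ℕ.+ Q)) ⟩
    r ^ (2 ℕ.+ (Q ℕ.+ Q))
      ≡⟨ cong (r ^_) (exponent m) ⟩
    r ^ (P ℕ.+ R)
      ≡⟨ ^-distribˡ-+-* r P R ⟩
    T * r ^ R ∎)
    where
    open ℚP.≤-Reasoning
    P Q R : ℕ
    P = (1 ℕ.+ m) ℕ.* (2 ℕ.+ m)
    Q = (2 ℕ.+ m) ℕ.* (3 ℕ.+ m)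
    R = (3 ℕ.+ m) ℕ.* (4 ℕ.+ m)
    E q r s T : ℚ
    E = a (2 ℕ.+ m)
    q = ratio (1 ℕ.+ m)
    r = ratio (2 ℕ.+ m)
    s = ratio (3 ℕ.+ m)
    T = r ^ P
    0<q : 0ℚ < q
    0<q = ratio-pos (1 ℕ.+ m)
    0<s : 0ℚ < s
    0<s = ratio-pos (3 ℕ.+ m)
    0<r*r : 0ℚ < r * r
    0<r*r = *-pos (ratio-pos (2 ℕ.+ m)) (ratio-pos (2 ℕ.+ m))
    0<T : 0ℚ < T
    0<T = ^-pos P (ratio-pos (2 ℕ.+ m))
    rearrange : ∀ x y z t → z * (x * y * (x * y) * t) ≡ x * x * (y * y * z * t)
    rearrange = solve 4 (λ x y z t → z :* (x :* y :* (x :* y) :* t)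
                                  := x :* x :* (y :* y :* z :* t)) refl
      where open ℚSolver.+-*-Solver
    exponent : ∀ m → 2 ℕ.+ ((2 ℕ.+ m) ℕ.* (3 ℕ.+ m) ℕ.+ (2 ℕ.+ m) ℕ.* (3 ℕ.+ m))
                     ≡ (1 ℕ.+ m) ℕ.* (2 ℕ.+ m) ℕ.+ (3 ℕ.+ m) ℕ.* (4 ℕ.+ m)
    exponent = solve-∀

  rootSeqStrictlyLogConcave :
    (∀ n → ratio (1 ℕ.+ n) * ratio (3 ℕ.+ n) ≤ ratio (2 ℕ.+ n) * ratio (2 ℕ.+ n)) →
    RootInequality 2 → RootSeqStrictlyLogConcave a
  rootSeqStrictlyLogConcave lc base = (λ n _ → a-pos n) , root
    where
    ratioRoot : ∀ m → RatioRootInequality m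
    ratioRoot zero    = root⇒ratioRoot 0 base
    ratioRoot (suc m) = ratioRoot-step lc m (ratioRoot m)
    root : ∀ n → 2 ℕ.≤ n → RootInequality n
    root (suc zero)    (s≤s ())
    root (suc (suc m)) _ = ratioRoot⇒root m (ratioRoot m)

record Certificate (A : Set) : Set where
  field
    multiplier target nonNegPart : A
    corrections                  : List (A × A)

-- Terms over an arbitrary signature of ring operations are written once and
-- then read both as rationals and as syntax for the ring solver.
record SemiringOps (A : Set) : Set where
  infixl 6 _⊕_
  infixl 7 _⊗_
  field
    _⊕_ _⊗_ : A → A → A
    lit     : ℕ → A

  horner : List ℕ → A → A
  horner []       x = lit 0
  horner (c ∷ cs) x = lit c ⊕ x ⊗ horner cs x

  pow : A → ℕ → A
  pow x zero    = lit 1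
  pow x (suc n) = x ⊗ pow x n

  -- For ps = p₀ ∷ … ∷ pₙ this is  Σᵢ pᵢ(x) uⁱ vⁿ⁻ⁱ.
  binaryForm : ℕ → List (List ℕ) → A → A → A → A
  binaryForm n []       x u v = lit 0
  binaryForm n (p ∷ ps) x u v = horner p x ⊗ pow v n ⊕ u ⊗ binaryForm (ℕ.pred n) ps x u v

  sumOfProducts : List (A × A) → A
  sumOfProducts []             = lit 0
  sumOfProducts ((k , e) ∷ ks) = k ⊗ e ⊕ sumOfProducts ks

  certificateˡ certificateʳ : Certificate A → A
  certificateˡ C = Certificate.multiplier C ⊗ Certificate.target C
  certificateʳ C = Certificate.nonNegPart C ⊕ sumOfProducts (Certificate.corrections C)

record RingOps (A : Set) : Set where
  infix  8 ⊝_
  infixl 6 _⊖_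
  field
    semiringOps : SemiringOps A
    ⊝_          : A → A
  open SemiringOps semiringOps public

  _⊖_ : A → A → A
  x ⊖ y = x ⊕ ⊝ y

ℕ-ops : SemiringOps ℕ
ℕ-ops = record { _⊕_ = ℕ._+_ ; _⊗_ = ℕ._*_ ; lit = λ c → c }

ℚ-ops : RingOps ℚ
ℚ-ops = record { semiringOps = record { _⊕_ = _+_ ; _⊗_ = _*_ ; lit = ℕ→ℚ } ; ⊝_ = -_ }

ℕ-solver-ops : ∀ {n} → SemiringOps (ℕSolver.+-*-Solver.Polynomial n)
ℕ-solver-ops = record { _⊕_ = _:+_ ; _⊗_ = _:*_ ; lit = con }
  where open ℕSolver.+-*-Solver

ℚ-solver-ops : ∀ {n} → RingOps (ℚSolver.+-*-Solver.Polynomial n)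
ℚ-solver-ops = record
  { semiringOps = record { _⊕_ = _:+_ ; _⊗_ = _:*_ ; lit = λ c → con (ℕ→ℚ c) } ; ⊝_ = :-_ }
  where open ℚSolver.+-*-Solver

open SemiringOps ℕ-ops using () renaming (horner to hornerℕ)

-- Coefficients, lowest degree first, of the Domb recurrence written at n = k + 2:
--   (k+2)³ D_{k+2} = 2(2k+3)(5(k+2)(k+1)+2) D_{k+1} − 64(k+1)³ D_k.
domb₂ domb₁ domb₀ : List ℕ
domb₂ = 8 ∷ 12 ∷ 6 ∷ 1 ∷ []
domb₁ = 72 ∷ 138 ∷ 90 ∷ 20 ∷ []
domb₀ = 64 ∷ 192 ∷ 192 ∷ 64 ∷ []

cubeStepCoefficients : List (List ℕ)
cubeStepCoefficients =
  (958365696 ∷ 2540617728 ∷ 2845630464 ∷ 1744736256 ∷ 632254464 ∷ 135413760 ∷ 15876096 ∷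
   786432 ∷ []) ∷
  (2338111488 ∷ 6671597568 ∷ 8104083456 ∷ 5459324928 ∷ 2223338496 ∷ 557952000 ∷ 83662848 ∷
   6770688 ∷ 221184 ∷ []) ∷
  (1774338048 ∷ 5427118080 ∷ 7053262848 ∷ 5082771456 ∷ 2219056128 ∷ 600219648 ∷ 98030592 ∷
   8810496 ∷ 331776 ∷ []) ∷
  (546324480 ∷ 1785397248 ∷ 2471657472 ∷ 1891467264 ∷ 874770432 ∷ 250312704 ∷ 43262976 ∷
   4125696 ∷ 165888 ∷ []) ∷
  (59719680 ∷ 207912960 ∷ 305897472 ∷ 247922688 ∷ 120956928 ∷ 36378624 ∷ 6589440 ∷ 657408 ∷
   27648 ∷ []) ∷
  []

module DombTerms {A : Set} (R : RingOps A) where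
  open RingOps R public

  residual : A → A → A → A → A
  residual k u v w = horner domb₂ k ⊗ w ⊖ (horner domb₁ k ⊗ v ⊖ horner domb₀ k ⊗ u)

  -- For u > 0: lowerGap ≥ 0 iff v/u ≥ (16x+24)/(x+3), and upperGap ≥ 0 iff v/u ≤ (32x+64)/(2x+7).
  lowerGap upperGap : A → A → A → A
  lowerGap x u v = horner (3 ∷ 1 ∷ []) x ⊗ v ⊖ horner (24 ∷ 16 ∷ []) x ⊗ u
  upperGap x u v = horner (64 ∷ 32 ∷ []) x ⊗ u ⊖ horner (7 ∷ 2 ∷ []) x ⊗ v

  lowerStepCertificate upperStepCertificate : A → A → A → A → Certificate A
  lowerStepCertificate x a b c = record
    { multiplier  = horner (384 ∷ 448 ∷ 152 ∷ 16 ∷ []) x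
    ; target      = lowerGap (lit 1 ⊕ x) b c
    ; nonNegPart  = horner domb₀ (lit 2 ⊕ x) ⊗ lowerGap x a b ⊕ horner (288 ∷ 624 ∷ 144 ∷ []) x ⊗ b
    ; corrections = (horner (24 ∷ 16 ∷ []) x , residual (lit 2 ⊕ x) a b c) ∷ []
    }
  upperStepCertificate x a b c = record
    { multiplier  = horner (4096 ∷ 5120 ∷ 2304 ∷ 448 ∷ 32 ∷ []) x
    ; target      = upperGap (lit 1 ⊕ x) b c
    ; nonNegPart  = horner domb₀ (lit 2 ⊕ x) ⊗ horner (9 ∷ 2 ∷ []) x ⊗ upperGap x a b
                    ⊕ horner (2112 ∷ 576 ∷ []) x ⊗ b
    ; corrections = (⊝ horner (576 ∷ 416 ∷ 64 ∷ []) x , residual (lit 2 ⊕ x) a b c) ∷ []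
    }

  -- Eliminating a and d with the two recurrences turns multiplier ⋅ (a c³ − b³ d) into a
  -- quartic form in the two gaps; the multiplier clears the leading coefficients of a and d.
  cubeStepCertificate : A → A → A → A → A → Certificate A
  cubeStepCertificate x a b c d = record
    { multiplier  = lit 331776 ⊗ horner domb₀ (lit 1 ⊕ x) ⊗ horner domb₂ (lit 2 ⊕ x)
    ; target      = a ⊗ pow c 3 ⊖ pow b 3 ⊗ d
    ; nonNegPart  = binaryForm 4 cubeStepCoefficients x (upperGap x b c) (lowerGap x b c)
    ; corrections = (lit 331776 ⊗ horner domb₂ (lit 2 ⊕ x) ⊗ pow c 3 , residual (lit 1 ⊕ x) a b c)
                  ∷ (⊝ (lit 21233664 ⊗ horner domb₂ x ⊗ pow b 3) , residual (lit 2 ⊕ x) b c d)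
                  ∷ []
    }

open DombTerms ℚ-ops

horner-cast : ∀ cs k → ℕ→ℚ (hornerℕ cs k) ≡ horner cs (ℕ→ℚ k)
horner-cast []       k = refl
horner-cast (c ∷ cs) k = begin
  ℕ→ℚ (c ℕ.+ k ℕ.* hornerℕ cs k)       ≡⟨ ℕ→ℚ-+ c (k ℕ.* hornerℕ cs k) ⟩
  ℕ→ℚ c + ℕ→ℚ (k ℕ.* hornerℕ cs k)     ≡⟨ cong (ℕ→ℚ c +_) (ℕ→ℚ-* k (hornerℕ cs k)) ⟩
  ℕ→ℚ c + ℕ→ℚ k * ℕ→ℚ (hornerℕ cs k)   ≡⟨ cong (λ y → ℕ→ℚ c + ℕ→ℚ k * y) (horner-cast cs k) ⟩
  ℕ→ℚ c + ℕ→ℚ k * horner cs (ℕ→ℚ k)   ∎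
  where open ≡-Reasoning

horner-nonNeg : ∀ cs {x} → 0ℚ ≤ x → 0ℚ ≤ horner cs x
horner-nonNeg []       0≤x = ℕ→ℚ-nonNeg 0
horner-nonNeg (c ∷ cs) 0≤x = +-nonNeg (ℕ→ℚ-nonNeg c) (*-nonNeg 0≤x (horner-nonNeg cs 0≤x))

horner-pos : ∀ c cs {x} → 0ℚ ≤ x → 0ℚ < horner (suc c ∷ cs) x
horner-pos c cs {x} 0≤x = subst (_< horner (suc c ∷ cs) x) (ℚP.+-identityʳ 0ℚ)
  (ℚP.+-mono-<-≤ (ℕ→ℚ-pos c) (*-nonNeg 0≤x (horner-nonNeg cs 0≤x)))

pow-nonNeg : ∀ {x} n → 0ℚ ≤ x → 0ℚ ≤ pow x n
pow-nonNeg zero    0≤x = ℕ→ℚ-nonNeg 1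
pow-nonNeg (suc n) 0≤x = *-nonNeg 0≤x (pow-nonNeg n 0≤x)

binaryForm-nonNeg : ∀ n ps {x u v} → 0ℚ ≤ x → 0ℚ ≤ u → 0ℚ ≤ v → 0ℚ ≤ binaryForm n ps x u v
binaryForm-nonNeg n []       0≤x 0≤u 0≤v = ℕ→ℚ-nonNeg 0
binaryForm-nonNeg n (p ∷ ps) 0≤x 0≤u 0≤v =
  +-nonNeg (*-nonNeg (horner-nonNeg p 0≤x) (pow-nonNeg n 0≤v))
           (*-nonNeg 0≤u (binaryForm-nonNeg (ℕ.pred n) ps 0≤x 0≤u 0≤v))

sumOfProducts-zero : ∀ ks → All (λ ke → proj₂ ke ≡ 0ℚ) ks → sumOfProducts ks ≡ 0ℚ
sumOfProducts-zero []             []           = refl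
sumOfProducts-zero ((k , e) ∷ ks) (e≡0 ∷ ks≡0) = begin
  k * e + sumOfProducts ks   ≡⟨ cong₂ (λ y z → k * y + z) e≡0 (sumOfProducts-zero ks ks≡0) ⟩
  k * 0ℚ + 0ℚ               ≡⟨ trans (ℚP.+-identityʳ (k * 0ℚ)) (ℚP.*-zeroʳ k) ⟩
  0ℚ                        ∎
  where open ≡-Reasoning

Valid : Certificate ℚ → Set
Valid C = certificateˡ C ≡ certificateʳ C

certificate-nonNeg : (C : Certificate ℚ) → let open Certificate C in
  0ℚ < multiplier → Valid C → All (λ ke → proj₂ ke ≡ 0ℚ) corrections →
  0ℚ ≤ nonNegPart → 0ℚ ≤ target
certificate-nonNeg C 0<m valid es≡0 0≤s =
  ℚP.*-cancelˡ-≤-pos multiplier {{ℚ.positive 0<m}} (begin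
    multiplier * 0ℚ                      ≡⟨ ℚP.*-zeroʳ multiplier ⟩
    0ℚ                                   ≤⟨ 0≤s ⟩
    nonNegPart                           ≡⟨ ℚP.+-identityʳ nonNegPart ⟨
    nonNegPart + 0ℚ                      ≡⟨ cong (nonNegPart +_) (sumOfProducts-zero corrections es≡0) ⟨
    nonNegPart + sumOfProducts corrections ≡⟨ valid ⟨
    multiplier * target                  ∎)
  where
  open Certificate C
  open ℚP.≤-Reasoning

domb₂-expansion : ∀ k → (2 ℕ.+ k) ℕ.^ 3 ≡ hornerℕ domb₂ k
domb₂-expansion = solve 1 (λ k → (con 2 :+ k) :^ 3 := SemiringOps.horner ℕ-solver-ops domb₂ k) refl
  where open ℕSolver.+-*-Solver

domb₁-expansion : ∀ k → 2 ℕ.* (3 ℕ.+ 2 ℕ.* k) ℕ.* (5 ℕ.* (2 ℕ.+ k) ℕ.* (1 ℕ.+ k) ℕ.+ 2) ≡ hornerℕ domb₁ k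
domb₁-expansion = solve 1 (λ k → con 2 :* (con 3 :+ con 2 :* k) :* (con 5 :* (con 2 :+ k) :* (con 1 :+ k) :+ con 2)
                               := SemiringOps.horner ℕ-solver-ops domb₁ k) refl
  where open ℕSolver.+-*-Solver

domb₀-expansion : ∀ k → 64 ℕ.* (1 ℕ.+ k) ℕ.^ 3 ≡ hornerℕ domb₀ k
domb₀-expansion = solve 1 (λ k → con 64 :* (con 1 :+ k) :^ 3 := SemiringOps.horner ℕ-solver-ops domb₀ k) refl
  where open ℕSolver.+-*-Solver


module Syntax {n} = DombTerms (ℚ-solver-ops {n})

lowerStepCertificate-valid : ∀ x a b c → Valid (lowerStepCertificate x a b c)
lowerStepCertificate-valid = solve 4 (λ x a b c →
  Syntax.certificateˡ (Syntax.lowerStepCertificate x a b c) := Syntax.certificateʳ (Syntax.lowerStepCertificate x a b c)) refl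
  where open ℚSolver.+-*-Solver

upperStepCertificate-valid : ∀ x a b c → Valid (upperStepCertificate x a b c)
upperStepCertificate-valid = solve 4 (λ x a b c →
  Syntax.certificateˡ (Syntax.upperStepCertificate x a b c) := Syntax.certificateʳ (Syntax.upperStepCertificate x a b c)) refl
  where open ℚSolver.+-*-Solver

cubeStepCertificate-valid : ∀ x a b c d → Valid (cubeStepCertificate x a b c d)
cubeStepCertificate-valid = solve 5 (λ x a b c d →
  Syntax.certificateˡ (Syntax.cubeStepCertificate x a b c d) := Syntax.certificateʳ (Syntax.cubeStepCertificate x a b c d)) refl
  where open ℚSolver.+-*-Solver

lowerGap⇒pos : ∀ {x u v} → 0ℚ ≤ x → 0ℚ < u → 0ℚ ≤ lowerGap x u v → 0ℚ < v
lowerGap⇒pos 0≤x 0<u 0≤gap = *-cancelˡ-pos (horner-nonNeg (3 ∷ 1 ∷ []) 0≤x)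
  (ℚP.<-≤-trans (*-pos (horner-pos 23 (16 ∷ []) 0≤x) 0<u) (0≤q-p⇒p≤q 0≤gap))

lower-step : ∀ x a b c → 0ℚ ≤ x → 0ℚ ≤ b → residual (ℕ→ℚ 2 + x) a b c ≡ 0ℚ →
             0ℚ ≤ lowerGap x a b → 0ℚ ≤ lowerGap (ℕ→ℚ 1 + x) b c
lower-step x a b c 0≤x 0≤b res≡0 0≤gap =
  certificate-nonNeg (lowerStepCertificate x a b c) (horner-pos 383 (448 ∷ 152 ∷ 16 ∷ []) 0≤x)
    (lowerStepCertificate-valid x a b c) (res≡0 ∷ [])
    (+-nonNeg (*-nonNeg (horner-nonNeg domb₀ (+-nonNeg (ℕ→ℚ-nonNeg 2) 0≤x)) 0≤gap)
              (*-nonNeg (horner-nonNeg (288 ∷ 624 ∷ 144 ∷ []) 0≤x) 0≤b))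

upper-step : ∀ x a b c → 0ℚ ≤ x → 0ℚ ≤ b → residual (ℕ→ℚ 2 + x) a b c ≡ 0ℚ →
             0ℚ ≤ upperGap x a b → 0ℚ ≤ upperGap (ℕ→ℚ 1 + x) b c
upper-step x a b c 0≤x 0≤b res≡0 0≤gap =
  certificate-nonNeg (upperStepCertificate x a b c)
    (horner-pos 4095 (5120 ∷ 2304 ∷ 448 ∷ 32 ∷ []) 0≤x)
    (upperStepCertificate-valid x a b c) (res≡0 ∷ [])
    (+-nonNeg (*-nonNeg (*-nonNeg (horner-nonNeg domb₀ (+-nonNeg (ℕ→ℚ-nonNeg 2) 0≤x))
                                  (horner-nonNeg (9 ∷ 2 ∷ []) 0≤x)) 0≤gap)
              (*-nonNeg (horner-nonNeg (2112 ∷ 576 ∷ []) 0≤x) 0≤b))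

cube-step : ∀ x a b c d → 0ℚ ≤ x →
            residual (ℕ→ℚ 1 + x) a b c ≡ 0ℚ → residual (ℕ→ℚ 2 + x) b c d ≡ 0ℚ →
            0ℚ ≤ lowerGap x b c → 0ℚ ≤ upperGap x b c → b ^ 3 * d ≤ a * c ^ 3
cube-step x a b c d 0≤x res₁≡0 res₂≡0 0≤L 0≤U = 0≤q-p⇒p≤q
  (certificate-nonNeg (cubeStepCertificate x a b c d) 0<m
    (cubeStepCertificate-valid x a b c d) (res₁≡0 ∷ res₂≡0 ∷ [])
    (binaryForm-nonNeg 4 cubeStepCoefficients 0≤x 0≤U 0≤L))
  where
  0<m : 0ℚ < ℕ→ℚ 331776 * horner domb₀ (ℕ→ℚ 1 + x) * horner domb₂ (ℕ→ℚ 2 + x)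
  0<m = *-pos (*-pos (ℕ→ℚ-pos 331775)
                     (horner-pos 63 (192 ∷ 192 ∷ 64 ∷ []) (+-nonNeg (ℕ→ℚ-nonNeg 1) 0≤x)))
              (horner-pos 7 (12 ∷ 6 ∷ 1 ∷ []) (+-nonNeg (ℕ→ℚ-nonNeg 2) 0≤x))

module Domb (D : ℕ → ℚ) (isDomb : IsDomb D) where

  D₀≡1 : D 0 ≡ 1ℚ
  D₀≡1 = proj₁ isDomb

  D₁≡4 : D 1 ≡ ℕ→ℚ 4
  D₁≡4 = proj₁ (proj₂ isDomb)

  D₂≡28 : D 2 ≡ ℕ→ℚ 28
  D₂≡28 = *-cancelˡ-≡-pos (ℕ→ℚ-pos 7)
    (trans (proj₂ (proj₂ isDomb) 0) (cong₂ (λ y z → ℕ→ℚ 72 * y - ℕ→ℚ 64 * z) D₁≡4 D₀≡1))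

  D₃≡256 : D 3 ≡ ℕ→ℚ 256
  D₃≡256 = *-cancelˡ-≡-pos (ℕ→ℚ-pos 26)
    (trans (proj₂ (proj₂ isDomb) 1) (cong₂ (λ y z → ℕ→ℚ 320 * y - ℕ→ℚ 512 * z) D₂≡28 D₁≡4))

  recurrence : ∀ k → residual (ℕ→ℚ k) (D k) (D (1 ℕ.+ k)) (D (2 ℕ.+ k)) ≡ 0ℚ
  recurrence k = p≡q⇒p-q≡0
    (trans (cong (_* D (2 ℕ.+ k)) (sym (cast domb₂ (domb₂-expansion k))))
    (trans (proj₂ (proj₂ isDomb) k)
           (cong₂ (λ y z → y * D (1 ℕ.+ k) - z * D k) (cast domb₁ (domb₁-expansion k))
                                                        (cast domb₀ (domb₀-expansion k)))))
    where
    cast : ∀ cs {e} → e ≡ hornerℕ cs k → ℕ→ℚ e ≡ horner cs (ℕ→ℚ k)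
    cast cs e≡ = trans (cong ℕ→ℚ e≡) (horner-cast cs k)

  recurrence-from : ∀ i j →
    residual (ℕ→ℚ i + ℕ→ℚ j) (D (i ℕ.+ j)) (D (1 ℕ.+ (i ℕ.+ j))) (D (2 ℕ.+ (i ℕ.+ j))) ≡ 0ℚ
  recurrence-from i j =
    subst (λ y → residual y (D (i ℕ.+ j)) (D (1 ℕ.+ (i ℕ.+ j))) (D (2 ℕ.+ (i ℕ.+ j))) ≡ 0ℚ)
          (ℕ→ℚ-+ i j) (recurrence (i ℕ.+ j))

  lower-bound : ∀ j → 0ℚ ≤ lowerGap (ℕ→ℚ j) (D (2 ℕ.+ j)) (D (3 ℕ.+ j)) × 0ℚ < D (3 ℕ.+ j)
  lower-bound zero =
    subst₂ (λ u v → 0ℚ ≤ lowerGap (ℕ→ℚ 0) u v) (sym D₂≡28) (sym D₃≡256) (≤-by-decision _ _) ,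
    subst (0ℚ <_) (sym D₃≡256) (<-by-decision _ _)
  lower-bound (suc j) = 0≤gap , lowerGap⇒pos (ℕ→ℚ-nonNeg (suc j)) 0<D₃₊ⱼ 0≤gap
    where
    0<D₃₊ⱼ = proj₂ (lower-bound j)
    0≤gap : 0ℚ ≤ lowerGap (ℕ→ℚ (suc j)) (D (3 ℕ.+ j)) (D (4 ℕ.+ j))
    0≤gap = subst (λ y → 0ℚ ≤ lowerGap y (D (3 ℕ.+ j)) (D (4 ℕ.+ j))) (sym (ℕ→ℚ-+ 1 j))
      (lower-step (ℕ→ℚ j) (D (2 ℕ.+ j)) (D (3 ℕ.+ j)) (D (4 ℕ.+ j)) (ℕ→ℚ-nonNeg j) (ℚP.<⇒≤ 0<D₃₊ⱼ) (recurrence-from 2 j)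
                  (proj₁ (lower-bound j)))

  D-pos : ∀ n → 0ℚ < D n
  D-pos 0 = subst (0ℚ <_) (sym D₀≡1) (<-by-decision _ _)
  D-pos 1 = subst (0ℚ <_) (sym D₁≡4) (<-by-decision _ _)
  D-pos 2 = subst (0ℚ <_) (sym D₂≡28) (<-by-decision _ _)
  D-pos (suc (suc (suc j))) = proj₂ (lower-bound j)

  upper-bound : ∀ j → 0ℚ ≤ upperGap (ℕ→ℚ j) (D (2 ℕ.+ j)) (D (3 ℕ.+ j))
  upper-bound zero =
    subst₂ (λ u v → 0ℚ ≤ upperGap (ℕ→ℚ 0) u v) (sym D₂≡28) (sym D₃≡256) (≤-by-decision _ _)
  upper-bound (suc j) = subst (λ y → 0ℚ ≤ upperGap y (D (3 ℕ.+ j)) (D (4 ℕ.+ j))) (sym (ℕ→ℚ-+ 1 j))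
    (upper-step (ℕ→ℚ j) (D (2 ℕ.+ j)) (D (3 ℕ.+ j)) (D (4 ℕ.+ j)) (ℕ→ℚ-nonNeg j) (ℚP.<⇒≤ (D-pos (3 ℕ.+ j))) (recurrence-from 2 j)
                (upper-bound j))

  cube-inequality : ∀ n → D (suc n) ^ 3 * D (3 ℕ.+ n) ≤ D n * D (2 ℕ.+ n) ^ 3
  cube-inequality zero = subst₂ _≤_
    (sym (cong₂ (λ u v → u ^ 3 * v) D₁≡4 D₃≡256)) (sym (cong₂ (λ u v → u * v ^ 3) D₀≡1 D₂≡28))
    (≤-by-decision _ _)
  cube-inequality (suc j) = cube-step (ℕ→ℚ j) (D (1 ℕ.+ j)) (D (2 ℕ.+ j)) (D (3 ℕ.+ j)) (D (4 ℕ.+ j)) (ℕ→ℚ-nonNeg j)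
    (recurrence-from 1 j) (recurrence-from 2 j) (proj₁ (lower-bound j)) (upper-bound j)

  open RatioSequence D D-pos public

  root-inequality₂ : RootInequality 2
  root-inequality₂ = subst₂ _<_
    (sym (cong₂ (λ u v → u ^ 6 * v ^ 2) D₁≡4 D₃≡256)) (sym (cong (_^ 6) D₂≡28))
    (<-by-decision _ _)

theorem4p9 : (D : ℕ → ℚ) → IsDomb D → RatioLogConcave D × RootSeqStrictlyLogConcave D
theorem4p9 D isDomb =
  ratioLogConcave ratio-lc , rootSeqStrictlyLogConcave (λ n → ratio-lc (suc n)) root-inequality₂
  where
  open Domb D isDomb
  ratio-lc = ratio-logConcave cube-inequality
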